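{- Let $H=(V_H,E_H)$ be an undirected multigraph with minimum cut size $\lambda_H=\lambda(H)$, and let $N_h\subseteq E_H$. Let $F_1,\ldots,F_m$ be a DA-msfd of order $m\geq \lambda_H+1$ of $H\setminus N_h$ (the graph $(V_H,E_H\setminus N_h)$), and let $H'=(V_H,E')$ be the graph with $E'=N_h\cup\bigcup_{i\leq \lambda_H+1}F_i$. Then for every nonempty proper subset $S\subsetneq V_H$, the cut $(S,V_H\setminus S)$ is a minimum cut in $H'$ if and only if it is a minimum cut in $H$.
   Context: For a multigraph $G=(V,E)$ and $\emptyset\neq S\subsetneq V$, $E_G(S,V\setminus S)$ is the multiset of edges with exactly one endpoint in $S$, and $\lambda(G)=\min_S |E_G(S,V\setminus S)|$; a minimum cut is a cut attaining this minimum. A maximal spanning forest decomposition (msfd) of order $k$ of $G$ is a decomposition into $k$ edge-disjoint forests $F_1,\ldots,F_k$ such that each $F_i$ is a maximal spanning forest of $G\setminus(F_1\cup\cdots\cup F_{i-1})$ (forests may be empty). A DA-msfd is the particular msfd produced by the $O(m+n)$-time algorithm of Nagamochi and Ibaraki. -}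

module Defs where

open import Data.Nat using (ℕ; zero; suc; _≤_; _<_; _<?_)
open import Data.Fin using (Fin; toℕ)
open import Data.Fin.Subset using (Subset; _∈_; _∉_; _⊆_; _∪_; _∩_; ∁; ⁅_⁆; ⋃; ∣_∣; Nonempty; ⊥; ⊤)
open import Data.Bool using (Bool; _xor_)
open import Data.Vec using (tabulate; lookup)
open import Data.List using (List; []; _∷_; map; filter; allFin)
open import Data.List.Relation.Unary.All using (All)
open import Data.List.Relation.Unary.Unique.Propositional using (Unique)
open import Data.Product using (Σ; ∃; _×_; _,_; proj₁; proj₂)
open import Relation.Binary.PropositionalEquality using (_≡_; _≢_)
open import Relation.Nullary using (¬_)

-- A multigraph on vertex set Fin n with k edges (edge identities Fin k);
-- ends e gives the two endpoints of edge e (self-loops allowed).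
Ends : ℕ → ℕ → Set
Ends n k = Fin k → Fin n × Fin n

-- A (sub)graph on the same vertex set is given by a subset of the edges.

module _ {n k : ℕ} (ends : Ends n k) where

  data Trail : Fin n → Fin n → List (Fin k) → Set where
    nil : ∀ {u} → Trail u u []
    fwd : ∀ {u w v e es} → ends e ≡ (u , w) → Trail w v es → Trail u v (e ∷ es)
    bwd : ∀ {u w v e es} → ends e ≡ (w , u) → Trail w v es → Trail u v (e ∷ es)

  HasCycle : Subset k → Set
  HasCycle F = Σ (Fin n) λ u → Σ (Fin k) λ e → Σ (List (Fin k)) λ es →
    Trail u u (e ∷ es) × Unique (e ∷ es) × All (_∈ F) (e ∷ es)

  IsForest : Subset k → Set
  IsForest F = ¬ HasCycle F

  IsMaxSpanningForest : Subset k → Subset k → Set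
  IsMaxSpanningForest A F =
    F ⊆ A × IsForest F × (∀ e → e ∈ A → e ∉ F → ¬ IsForest (F ∪ ⁅ e ⁆))

  -- union of F_i over indices i with toℕ i < j  (i.e. F_1 ∪ ... ∪ F_j, 1-based)
  UnionBelow : ∀ {m} → (Fin m → Subset k) → ℕ → Subset k
  UnionBelow {m} F j = ⋃ (map F (filter (λ i → toℕ i <? j) (allFin m)))

  IsMSFD : ∀ {m} → Subset k → (Fin m → Subset k) → Set
  IsMSFD {m} A F =
    (∀ i j → i ≢ j → F i ∩ F j ≡ ⊥) ×
    ⋃ (map F (allFin m)) ≡ A ×
    (∀ i → IsMaxSpanningForest (A ∩ ∁ (UnionBelow F (toℕ i))) (F i))

  Crossing : Subset n → Subset k
  Crossing S = tabulate λ e → lookup S (proj₁ (ends e)) xor lookup S (proj₂ (ends e))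

  cutSize : Subset k → Subset n → ℕ
  cutSize A S = ∣ A ∩ Crossing S ∣

  Proper : Subset n → Set
  Proper S = Nonempty S × Nonempty (∁ S)

  IsMinCut : Subset k → Subset n → Set
  IsMinCut A S = Proper S × (∀ T → Proper T → cutSize A S ≤ cutSize A T)

  IsMinCutValue : Subset k → ℕ → Set
  IsMinCutValue A l =
    (Σ (Subset n) λ S → Proper S × cutSize A S ≡ l) ×
    (∀ T → Proper T → l ≤ cutSize A T)

-- Let H' be the graph N ∪ F₁ ∪ ⋯ ∪ F_{λ+1}. A cut of H' is a cut of H with
-- some edges removed, so it is never larger. If a cut (T, V∖T) of H loses an
-- edge e in H', then e ∉ N and e avoids F₁,…,F_{λ+1}; since each Fᵢ is a
-- maximal spanning forest of a graph still containing e, Fᵢ must contain an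
-- edge crossing T (otherwise adding e would close a cycle crossing the cut
-- exactly once, impossible by parity). These λ+1 edges are distinct, so the
-- cut of T in H' has size > λ. Hence every cut of H' either equals its cut
-- in H or exceeds λ, and both graphs have minimum cut value λ, attained by
-- the same sets.
module Submission where

open import Defs
open import Data.Bool using (Bool; true; false; _xor_)
open import Data.Bool.Properties using (xor-same; xor-comm)
open import Data.Empty using (⊥-elim)
open import Data.Fin using (Fin; toℕ; fromℕ<; _≟_)
open import Data.Fin.Properties using (toℕ-fromℕ<; any?)
open import Data.Fin.Subset using (Subset; _∈_; _∉_; _⊆_; _∪_; _∩_; ∁; ⁅_⁆; ⋃; Nonempty; ⊤)
open import Data.Fin.Subset.Properties
  using (x∈p∪q⁻; x∈p∪q⁺; q⊆p∪q; x∈p∩q⁻; x∈p∩q⁺; ∉⊥; x∈⁅y⁆⇒x≡y; ∈⊤; p⊆q⇒∣p∣≤∣q∣; p⊂q⇒∣p∣<∣q∣;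
         nonempty?; x∉p⇒x∈∁p; _∈?_)
open import Data.List using (List; []; _∷_; map; filter; allFin)
import Data.List.Membership.Propositional as List
open import Data.List.Membership.Propositional.Properties using (∈-map∘filter⁺; ∈-map∘filter⁻; ∈-allFin)
open import Data.List.Relation.Unary.All using (All; []; _∷_)
import Data.List.Relation.Unary.All as All
open import Data.List.Relation.Unary.AllPairs using (_∷_)
import Data.List.Relation.Unary.Any as Any
open import Data.List.Relation.Unary.Any using (here; there)
open import Data.List.Relation.Unary.Unique.Propositional using (Unique)
open import Data.Nat using (ℕ; zero; suc; _≤_; _<_; _<?_; z≤n; s≤s)
open import Data.Nat.Properties using (≤-refl; ≤-trans; ≤-reflexive; n≤1+n; m<n⇒m<1+n; <-irrefl; <⇒≤; <⇒≱)
open import Data.Vec using (lookup)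
open import Data.Vec.Properties using (lookup∘tabulate; []=⇒lookup; lookup⇒[]=)
open import Data.Product using (∃-syntax; _×_; _,_; proj₁; proj₂)
open import Data.Sum using (_⊎_; inj₁; inj₂)
open import Function using (_∘_; case_of_)
open import Function.Bundles using (_⇔_; mk⇔)
open import Relation.Binary.PropositionalEquality using (_≡_; _≢_; refl; sym; trans; cong; cong₂; subst)
open import Relation.Nullary using (¬_; yes; no)
open import Relation.Nullary.Decidable using (¬?; _×-dec_)

x∈⋃⁻ : ∀ {k} {x : Fin k} (ps : List (Subset k)) → x ∈ ⋃ ps → ∃[ p ] p List.∈ ps × x ∈ p
x∈⋃⁻ []       x∈ = ⊥-elim (∉⊥ x∈)
x∈⋃⁻ (p ∷ ps) x∈ with x∈p∪q⁻ p (⋃ ps) x∈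
... | inj₁ x∈p  = p , here refl , x∈p
... | inj₂ x∈ps with x∈⋃⁻ ps x∈ps
...   | q , q∈ps , x∈q = q , there q∈ps , x∈q

x∈⋃⁺ : ∀ {k} {x : Fin k} {p} (ps : List (Subset k)) → p List.∈ ps → x ∈ p → x ∈ ⋃ ps
x∈⋃⁺ (q ∷ ps) (here refl) x∈p = x∈p∪q⁺ (inj₁ x∈p)
x∈⋃⁺ (q ∷ ps) (there p∈)  x∈p = x∈p∪q⁺ (inj₂ (x∈⋃⁺ ps p∈ x∈p))

x∈p∪⁅y⁆⇒x∈p : ∀ {k} {x y : Fin k} (p : Subset k) → x ∈ p ∪ ⁅ y ⁆ → x ≢ y → x ∈ p
x∈p∪⁅y⁆⇒x∈p {y = y} p x∈ x≢y with x∈p∪q⁻ p ⁅ y ⁆ x∈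
... | inj₁ x∈p = x∈p
... | inj₂ x∈y = ⊥-elim (x≢y (x∈⁅y⁆⇒x≡y y x∈y))

xor-telescope : ∀ a b c → a xor c ≡ (a xor b) xor (b xor c)
xor-telescope true  true  c     = refl
xor-telescope true  false c     = refl
xor-telescope false true  true  = refl
xor-telescope false true  false = refl
xor-telescope false false c     = refl

xor-extend : ∀ {b c p} a v → c ≡ a xor b → b xor v ≡ p → a xor v ≡ c xor p
xor-extend {b} a v c≡ab bv≡p = trans (xor-telescope a b v) (cong₂ _xor_ (sym c≡ab) bv≡p)

module _ {n k : ℕ} (ends : Ends n k) where

  crosses : Subset n → Fin k → Bool
  crosses S e = lookup (Crossing ends S) e

  crosses-ends : ∀ S e {a b} → ends e ≡ (a , b) → crosses S e ≡ lookup S a xor lookup S b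
  crosses-ends S e ends≡ =
    trans (lookup∘tabulate _ e) (cong (λ ab → lookup S (proj₁ ab) xor lookup S (proj₂ ab)) ends≡)

  crossingParity : Subset n → List (Fin k) → Bool
  crossingParity S []       = false
  crossingParity S (e ∷ es) = crosses S e xor crossingParity S es

  trail-crossingParity : ∀ S {u v es} → Trail ends u v es →
                         lookup S u xor lookup S v ≡ crossingParity S es
  trail-crossingParity S {u} nil = xor-same (lookup S u)
  trail-crossingParity S {u} {v} (fwd {e = e} ends≡ t) =
    xor-extend (lookup S u) (lookup S v) (crosses-ends S e ends≡) (trail-crossingParity S t)
  trail-crossingParity S {u} {v} (bwd {w = w} {e = e} ends≡ t) =
    xor-extend (lookup S u) (lookup S v) (trans (crosses-ends S e ends≡) (xor-comm (lookup S w) (lookup S u)))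
               (trail-crossingParity S t)

  crossingParity-noCrossing : ∀ S {es} → All (λ e → crosses S e ≡ false) es → crossingParity S es ≡ false
  crossingParity-noCrossing S []            = refl
  crossingParity-noCrossing S (c≡f ∷ c≡fs) rewrite c≡f = crossingParity-noCrossing S c≡fs

  crossingParity-oneCrossing : ∀ S e {es} → Unique es → e List.∈ es → crosses S e ≡ true →
                               (∀ {y} → y List.∈ es → y ≢ e → crosses S y ≡ false) →
                               crossingParity S es ≡ true
  crossingParity-oneCrossing S e (e∉es ∷ _) (here refl) c≡t others rewrite c≡t
    | crossingParity-noCrossing S
        (All.tabulate λ y∈ → others (there y∈) (λ { refl → All.lookup e∉es y∈ refl }))
    = refl
  crossingParity-oneCrossing S e (x≢es ∷ uq) (there e∈) c≡t others
    rewrite others (here refl) (λ { refl → All.lookup x≢es e∈ refl })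
    = crossingParity-oneCrossing S e uq e∈ c≡t (λ y∈ → others (there y∈))

  -- A cycle through e would cross the cut an odd number of times.
  forest-∪-crossing : ∀ S G e → IsForest ends G → e ∈ Crossing ends S →
                      ¬ Nonempty (G ∩ Crossing ends S) → IsForest ends (G ∪ ⁅ e ⁆)
  forest-∪-crossing S G e forest e∈S noCrossing (u , e₀ , es , tr , uq , inG∪e)
    with Any.any? (e ≟_) (e₀ ∷ es)
  ... | no e∉cycle = forest (u , e₀ , es , tr , uq , All.tabulate λ y∈ →
          x∈p∪⁅y⁆⇒x∈p G (All.lookup inG∪e y∈) λ { refl → e∉cycle y∈ })
  ... | yes e∈cycle = case trans (sym evenCrossings) oddCrossings of λ ()
    where
    evenCrossings : crossingParity S (e₀ ∷ es) ≡ false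
    evenCrossings = trans (sym (trail-crossingParity S tr)) (xor-same (lookup S u))
    othersSame : ∀ {y} → y List.∈ (e₀ ∷ es) → y ≢ e → crosses S y ≡ false
    othersSame {y} y∈ y≢e with crosses S y in c≡
    ... | false = refl
    ... | true  = ⊥-elim (noCrossing (y , x∈p∩q⁺
                    (x∈p∪⁅y⁆⇒x∈p G (All.lookup inG∪e y∈) y≢e , lookup⇒[]= y (Crossing ends S) c≡)))
    oddCrossings : crossingParity S (e₀ ∷ es) ≡ true
    oddCrossings = crossingParity-oneCrossing S e uq e∈cycle ([]=⇒lookup e∈S) othersSame

  maxSpanningForest-crossing : ∀ S {A G e} → IsMaxSpanningForest ends A G → e ∈ A → e ∉ G →
                               e ∈ Crossing ends S → Nonempty (G ∩ Crossing ends S)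
  maxSpanningForest-crossing S {G = G} {e} (_ , forest , maximal) e∈A e∉G e∈S
    with nonempty? (G ∩ Crossing ends S)
  ... | yes crossing  = crossing
  ... | no noCrossing = ⊥-elim (maximal e e∈A e∉G (forest-∪-crossing S G e forest e∈S noCrossing))

  cutSize-mono : ∀ {B B′} S → (∀ {x} → x ∈ B → x ∈ Crossing ends S → x ∈ B′) →
                 cutSize ends B S ≤ cutSize ends B′ S
  cutSize-mono {B} S B⊆B′ = p⊆q⇒∣p∣≤∣q∣ λ x∈ →
    let x∈B , x∈S = x∈p∩q⁻ B (Crossing ends S) x∈ in x∈p∩q⁺ (B⊆B′ x∈B x∈S , x∈S)

  cutSize-mono-< : ∀ {B B′ x} S → B ⊆ B′ → x ∈ B′ ∩ Crossing ends S → x ∉ B →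
                   cutSize ends B S < cutSize ends B′ S
  cutSize-mono-< {B} S B⊆B′ x∈ x∉B = p⊂q⇒∣p∣<∣q∣
    ( (λ y∈ → let y∈B , y∈S = x∈p∩q⁻ B (Crossing ends S) y∈ in x∈p∩q⁺ (B⊆B′ y∈B , y∈S))
    , _ , x∈ , λ x∈B∩ → x∉B (proj₁ (x∈p∩q⁻ B (Crossing ends S) x∈B∩)) )

  module _ {m : ℕ} (F : Fin m → Subset k) where

    ∈UnionBelow⁻ : ∀ j {x} → x ∈ UnionBelow ends F j → ∃[ i ] toℕ i < j × x ∈ F i
    ∈UnionBelow⁻ j x∈ with x∈⋃⁻ (map F (filter (λ i → toℕ i <? j) (allFin m))) x∈
    ... | p , p∈ , x∈p with ∈-map∘filter⁻ F (λ i → toℕ i <? j) {xs = allFin m} p∈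
    ...   | i , _ , refl , i<j = i , i<j , x∈p

    ∈UnionBelow⁺ : ∀ j {x} i → toℕ i < j → x ∈ F i → x ∈ UnionBelow ends F j
    ∈UnionBelow⁺ j i i<j x∈ = x∈⋃⁺ (map F (filter (λ i → toℕ i <? j) (allFin m)))
      (∈-map∘filter⁺ F (λ i → toℕ i <? j) {xs = allFin m} (i , ∈-allFin i , refl , i<j)) x∈

    UnionBelow-⊆-suc : ∀ j → UnionBelow ends F j ⊆ UnionBelow ends F (suc j)
    UnionBelow-⊆-suc j x∈ with ∈UnionBelow⁻ j x∈
    ... | i , i<j , x∈i = ∈UnionBelow⁺ (suc j) i (m<n⇒m<1+n i<j) x∈i

    msfd-∉UnionBelow : ∀ {A i x} → IsMSFD ends A F → x ∈ F i → x ∉ UnionBelow ends F (toℕ i)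
    msfd-∉UnionBelow {i = i} {x} (disjoint , _) x∈i x∈below with ∈UnionBelow⁻ (toℕ i) x∈below
    ... | i′ , i′<i , x∈i′ = ∉⊥ (subst (x ∈_) (disjoint i′ i i′≢i) (x∈p∩q⁺ (x∈i′ , x∈i)))
      where
      i′≢i : i′ ≢ i
      i′≢i refl = <-irrefl refl i′<i

    msfd-crossing : ∀ S {A e} → IsMSFD ends A F → e ∈ A → e ∈ Crossing ends S →
                    ∀ i → e ∉ UnionBelow ends F (suc (toℕ i)) → Nonempty (F i ∩ Crossing ends S)
    msfd-crossing S (_ , _ , maximal) e∈A e∈S i e∉below =
      maxSpanningForest-crossing S (maximal i)
        (x∈p∩q⁺ (e∈A , x∉p⇒x∈∁p (λ e∈ → e∉below (UnionBelow-⊆-suc (toℕ i) e∈))))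
        (λ e∈i → e∉below (∈UnionBelow⁺ (suc (toℕ i)) i ≤-refl e∈i))
        e∈S

    msfd-cutSize-UnionBelow : ∀ S {A e} → IsMSFD ends A F → e ∈ A → e ∈ Crossing ends S →
                              ∀ j → j ≤ m → e ∉ UnionBelow ends F j →
                              j ≤ cutSize ends (UnionBelow ends F j) S
    msfd-cutSize-UnionBelow S msfd e∈A e∈S zero    _   _ = z≤n
    msfd-cutSize-UnionBelow S {e = e} msfd e∈A e∈S (suc j) j<m e∉below =
      ≤-trans (s≤s below-j) (cutSize-mono-< S (UnionBelow-⊆-suc j) e′∈below-suc-j e′∉below-j)
      where
      i : Fin m
      i = fromℕ< j<m
      i≡j : toℕ i ≡ j
      i≡j = toℕ-fromℕ< j<m
      below-j : j ≤ cutSize ends (UnionBelow ends F j) S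
      below-j = msfd-cutSize-UnionBelow S msfd e∈A e∈S j (<⇒≤ j<m) (e∉below ∘ UnionBelow-⊆-suc j)
      crossing : Nonempty (F i ∩ Crossing ends S)
      crossing = msfd-crossing S msfd e∈A e∈S i (subst (λ j → e ∉ UnionBelow ends F (suc j)) (sym i≡j) e∉below)
      e′∈i×S : proj₁ crossing ∈ F i × proj₁ crossing ∈ Crossing ends S
      e′∈i×S = x∈p∩q⁻ (F i) (Crossing ends S) (proj₂ crossing)
      e′∈below-suc-j : proj₁ crossing ∈ UnionBelow ends F (suc j) ∩ Crossing ends S
      e′∈below-suc-j = x∈p∩q⁺ (∈UnionBelow⁺ (suc j) i (s≤s (≤-reflexive i≡j)) (proj₁ e′∈i×S) , proj₂ e′∈i×S)
      e′∉below-j : proj₁ crossing ∉ UnionBelow ends F j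
      e′∉below-j = subst (λ j → proj₁ crossing ∉ UnionBelow ends F j) i≡j (msfd-∉UnionBelow msfd (proj₁ e′∈i×S))

  msfd-cutSize-complete-or-large : ∀ {m N l} {F : Fin m → Subset k} → IsMSFD ends (∁ N) F → suc l ≤ m →
    ∀ T → cutSize ends ⊤ T ≤ cutSize ends (N ∪ UnionBelow ends F (suc l)) T
        ⊎ suc l ≤ cutSize ends (N ∪ UnionBelow ends F (suc l)) T
  msfd-cutSize-complete-or-large {N = N} {l} {F} msfd l<m T
    with any? (λ x → (x ∈? Crossing ends T) ×-dec ¬? (x ∈? H))
    where
    H : Subset k
    H = N ∪ UnionBelow ends F (suc l)
  ... | yes (x , x∈T , x∉H) = inj₂ (≤-trans
          (msfd-cutSize-UnionBelow F T msfd (x∉p⇒x∈∁p (x∉H ∘ x∈p∪q⁺ ∘ inj₁)) x∈T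
                                   (suc l) l<m (x∉H ∘ x∈p∪q⁺ ∘ inj₂))
          (cutSize-mono T λ x∈ _ → q⊆p∪q N (UnionBelow ends F (suc l)) x∈))
  ... | no noneMissing = inj₁ (cutSize-mono {B = ⊤} T crossing⇒∈H)
    where
    crossing⇒∈H : ∀ {x} → x ∈ ⊤ → x ∈ Crossing ends T → x ∈ N ∪ UnionBelow ends F (suc l)
    crossing⇒∈H {x} _ x∈T with x ∈? (N ∪ UnionBelow ends F (suc l))
    ... | yes x∈H = x∈H
    ... | no  x∉H = ⊥-elim (noneMissing (x , x∈T , x∉H))

lemma3 : ∀ {n k} (ends : Ends n k) (λH : ℕ) → IsMinCutValue ends ⊤ λH →
         (N : Subset k) (m : ℕ) → suc λH ≤ m → (F : Fin m → Subset k) →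
         IsMSFD ends (∁ N) F →
         ∀ (S : Subset n) → Proper ends S →
         (IsMinCut ends (N ∪ UnionBelow ends F (suc λH)) S ⇔ IsMinCut ends ⊤ S)
lemma3 ends λH ((S₀ , S₀-proper , cutS₀≡λH) , λH-lower) N m λH<m F msfd S S-proper =
  mk⇔ (λ (_ , minH′) → S-proper , minH′⇒minH minH′) (λ (_ , minH) → S-proper , minH⇒minH′ minH)
  where
  cut cut′ : Subset _ → ℕ
  cut  = cutSize ends ⊤
  cut′ = cutSize ends (N ∪ UnionBelow ends F (suc λH))
  cut′≤cut : ∀ T → cut′ T ≤ cut T
  cut′≤cut T = cutSize-mono ends {B = N ∪ UnionBelow ends F (suc λH)} T λ _ _ → ∈⊤
  cut′S₀≤λH : cut′ S₀ ≤ λH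
  cut′S₀≤λH = ≤-trans (cut′≤cut S₀) (≤-reflexive cutS₀≡λH)
  λH≤cut′ : ∀ T → Proper ends T → λH ≤ cut′ T
  λH≤cut′ T T-proper with msfd-cutSize-complete-or-large ends msfd λH<m T
  ... | inj₁ cut≤cut′ = ≤-trans (λH-lower T T-proper) cut≤cut′
  ... | inj₂ λH<cut′  = ≤-trans (n≤1+n λH) λH<cut′
  minH′⇒minH : (∀ T → Proper ends T → cut′ S ≤ cut′ T) → ∀ T → Proper ends T → cut S ≤ cut T
  minH′⇒minH minH′ T T-proper with msfd-cutSize-complete-or-large ends msfd λH<m S
  ... | inj₁ cut≤cut′ =
    ≤-trans cut≤cut′ (≤-trans (minH′ S₀ S₀-proper) (≤-trans cut′S₀≤λH (λH-lower T T-proper)))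
  ... | inj₂ λH<cut′  = ⊥-elim (<⇒≱ λH<cut′ (≤-trans (minH′ S₀ S₀-proper) cut′S₀≤λH))
  minH⇒minH′ : (∀ T → Proper ends T → cut S ≤ cut T) → ∀ T → Proper ends T → cut′ S ≤ cut′ T
  minH⇒minH′ minH T T-proper =
    ≤-trans (cut′≤cut S) (≤-trans (minH S₀ S₀-proper) (≤-trans (≤-reflexive cutS₀≡λH) (λH≤cut′ T T-proper)))
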